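{- Let $v \ge 19$ and let $S$ be a Steiner triple system $\mathrm{STS}(v)$ which has an independent set $I$ of cardinality $8$. Then $S$ admits a $4$-good sequencing.
   Context: A Steiner triple system $\mathrm{STS}(v)$ is a pair $(V,\mathcal{B})$ where $V$ is a set of $v$ points and $\mathcal{B}$ is a collection of $3$-element subsets of $V$ (blocks) such that every pair of distinct points lies in exactly one block. An independent set is a subset of $V$ containing no block. For an integer $\ell \ge 3$, an $\ell$-good sequencing is an ordering $x_1,\dots,x_v$ of all points of $V$ such that no $\ell$ consecutive points $x_i,\dots,x_{i+\ell-1}$ contain a block. -}

module Defs where

open import Data.Nat using (ℕ; _+_; _≤_; _<_)
open import Data.Fin using (Fin; toℕ)
open import Data.Fin.Permutation using (Permutation′; _⟨$⟩ʳ_)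
open import Data.List using (List; length)
open import Data.List.Membership.Propositional using (_∈_)
open import Data.List.Relation.Unary.Unique.Propositional using (Unique)
open import Data.Product using (Σ; ∃; _×_; _,_)
open import Relation.Binary.PropositionalEquality using (_≡_; _≢_)
open import Relation.Nullary using (¬_)

record Block (v : ℕ) : Set where
  constructor blk
  field
    p₁ p₂ p₃ : Fin v
    p₁<p₂    : toℕ p₁ < toℕ p₂
    p₂<p₃    : toℕ p₂ < toℕ p₃

open Block public

_∈B_ : {v : ℕ} → Fin v → Block v → Set
x ∈B B = (x ≡ p₁ B) Data.Sum.⊎ ((x ≡ p₂ B) Data.Sum.⊎ (x ≡ p₃ B))
  where import Data.Sum

record STS (v : ℕ) : Set where
  field
    blocks   : List (Block v)
    distinct : Unique blocks
    covers   : (x y : Fin v) → x ≢ y →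
               ∃ λ B → B ∈ blocks × x ∈B B × y ∈B B
    unique   : (x y : Fin v) → x ≢ y → (B C : Block v) →
               B ∈ blocks → C ∈ blocks →
               x ∈B B → y ∈B B → x ∈B C → y ∈B C → B ≡ C

open STS public

_⊆P_ : {v : ℕ} → Block v → (Fin v → Set) → Set
B ⊆P P = P (p₁ B) × P (p₂ B) × P (p₃ B)

IsIndependent : {v : ℕ} → STS v → List (Fin v) → Set
IsIndependent {v} S I = Unique I × ((B : Block v) → B ∈ blocks S → ¬ (B ⊆P (λ x → x ∈ I)))

-- An ℓ-good sequencing: an ordering x_0, …, x_{v-1} of all points (a bijection
-- σ : Fin v → Fin v, position i ↦ point x_i) such that no ℓ consecutive points
-- x_i, …, x_{i+ℓ-1} contain a block.
IsGoodSequencing : {v : ℕ} → STS v → ℕ → Permutation′ v → Set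
IsGoodSequencing {v} S ℓ σ =
  (i : ℕ) → i + ℓ ≤ v → (B : Block v) → B ∈ blocks S →
  ¬ (B ⊆P (λ x → Σ (Fin v) λ j → (i ≤ toℕ j) × (toℕ j < i + ℓ) × (σ ⟨$⟩ʳ j ≡ x)))

-- Build the sequence greedily, one point at a time. A new point x only has to
-- avoid forming a block with two of the three points placed just before it, and
-- each of these at most three pairs excludes at most one candidate (the third
-- point of the block through the pair); so among four or more remaining
-- candidates one is always admissible. Placing the v - 8 points outside the
-- independent set I this way only gets stuck when three of them, z₁ z₂ z₃, are
-- left. These are interleaved with the eight points of I as
-- a₁ z₁ a₂ z₂ a₃ z₃ a₄ … a₈, where each aᵢ is chosen among the unused points of I
-- so that it also avoids the pairs it will form with the later z's, while triples
-- inside I need no care since I is independent. The constraints on a₁, …, a₆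
-- number 6, 6, 5, 3, 3, 2 against 8, 7, 6, 5, 4, 3 candidates.

module Submission where

open import Defs
open import Data.Empty using (⊥-elim)
open import Data.Fin using (Fin; toℕ; cast) renaming (zero to fzero; suc to fsuc)
open import Data.Fin.Properties using (_≟_; toℕ-cast)
open import Data.Fin.Permutation
  using (Permutation; Permutation′; _⟨$⟩ʳ_; permutation; ↔⇒≡; cast-id; _∘ₚ_)
open import Data.List using (List; []; _∷_; _++_; length; lookup; take; drop; map; filter; allFin)
open import Data.List.Membership.Propositional using (_∈_; _∉_; find; lose)
import Data.List.Membership.DecPropositional as DecMembership
import Data.List.Relation.Unary.Unique.DecPropositional as DecUnique
open import Data.List.Properties using (length-++; ++-assoc)
open import Data.List.Membership.Propositional.Properties
  using (∈-∃++; ∈-lookup; ∈-filter⁺; ∈-allFin; ∈-++⁺ˡ; ∈-++⁺ʳ; ∈-map⁺)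
open import Data.List.Relation.Binary.Permutation.Propositional
  using (_↭_; ↭-refl; ↭-reflexive; ↭-sym; ↭-trans; ↭-prep; ↭-swap; ↭⇒↭ₛ; module PermutationReasoning)
open import Data.List.Relation.Binary.Permutation.Propositional.Properties
  using (↭-length; ∈-resp-↭; All-resp-↭; shift; shifts; ++⁺ˡ; ++⁺ʳ; ++⁺; ++-comm; ↭-reverse)
import Data.List.Relation.Binary.Permutation.Setoid.Properties as PermutationSetoid
open import Data.List.Relation.Unary.All as All using (All; []; _∷_)
open import Data.List.Relation.Unary.Any as Any using (Any; here; there; index; any?)
open import Data.List.Relation.Unary.All.Properties using (¬Any⇒All¬; all-filter)
import Data.List.Relation.Unary.Unique.Propositional.Properties as Unique
open import Data.List.Relation.Unary.Any.Properties using (lookup-index)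
open import Data.List.Relation.Unary.AllPairs as AllPairs using ([]; _∷_)
open import Data.List.Relation.Unary.Unique.Propositional using (Unique)
open import Data.Nat using (ℕ; zero; suc; _+_; _∸_; _≤_; _<_; z≤n; s≤s)
open import Data.Nat.Properties
  using ( suc-injective; <⇒≢; <-trans; <-irrefl; ≤-refl; ≤-trans; ≤-reflexive; m≤n⇒m≤1+n; n≤1+n
        ; m≤n+m; +-suc; +-monoˡ-≤; +-identityʳ; +-cancelʳ-≤; ∸-monoˡ-≤; m∸n+n≡m )
open import Data.Product using (Σ; ∃; ∃₂; _×_; _,_; proj₁)
open import Data.Sum using (_⊎_; inj₁; inj₂)
open import Data.Unit using (⊤; tt)
open import Function using (_∘_; id)
open import Relation.Nullary using (¬_; ¬?; Dec; yes; no)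
open import Relation.Nullary.Decidable using (_×-dec_; _⊎-dec_)
open import Relation.Binary.PropositionalEquality
  using (_≡_; _≢_; refl; sym; trans; cong; subst; setoid; module ≡-Reasoning)

module _ {a} {A : Set a} where

  ∈-∃↭ : ∀ {x : A} {xs} → x ∈ xs → ∃ λ ys → xs ↭ x ∷ ys
  ∈-∃↭ {x} x∈xs with ys , zs , refl ← ∈-∃++ x∈xs = ys ++ zs , shift x ys zs

  Unique-resp-↭ : ∀ {xs ys : List A} → xs ↭ ys → Unique xs → Unique ys
  Unique-resp-↭ p = PermutationSetoid.Unique-resp-↭ (setoid A) (↭⇒↭ₛ p)

  Unique-⊆⇒length≤ : ∀ {xs ys : List A} → Unique xs → (∀ {z} → z ∈ xs → z ∈ ys) →
                     length xs ≤ length ys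
  Unique-⊆⇒length≤ {[]}     _            _     = z≤n
  Unique-⊆⇒length≤ {x ∷ xs} {ys} (x∉xs ∷ u) xs⊆ys with ∈-∃↭ (xs⊆ys (here refl))
  ... | ys′ , ys↭ =
    subst (suc (length xs) ≤_) (sym (↭-length ys↭)) (s≤s (Unique-⊆⇒length≤ u xs⊆ys′))
    where
    xs⊆ys′ : ∀ {z} → z ∈ xs → z ∈ ys′
    xs⊆ys′ z∈xs with ∈-resp-↭ ys↭ (xs⊆ys (there z∈xs))
    ... | here refl    = ⊥-elim (All.lookup x∉xs z∈xs refl)
    ... | there z∈ys′ = z∈ys′

  lookup∈take : ∀ (xs : List A) (j : Fin (length xs)) {n} → toℕ j < n → lookup xs j ∈ take n xs
  lookup∈take (x ∷ xs) fzero    {suc n} _         = here refl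
  lookup∈take (x ∷ xs) (fsuc j) {suc n} (s≤s j<n) = there (lookup∈take xs j j<n)

  ∈-take-suc : ∀ {z : A} n xs → z ∈ take n xs → z ∈ take (suc n) xs
  ∈-take-suc (suc n) (x ∷ xs) (here e)  = here e
  ∈-take-suc (suc n) (x ∷ xs) (there p) = there (∈-take-suc n xs p)

  lookup∈window : ∀ (xs : List A) i (j : Fin (length xs)) {n} → i ≤ toℕ j → toℕ j < i + n →
                  lookup xs j ∈ take n (drop i xs)
  lookup∈window xs       zero    j        _         j<n       = lookup∈take xs j j<n
  lookup∈window (x ∷ xs) (suc i) (fsuc j) (s≤s i≤j) (s≤s j<n) = lookup∈window xs i j i≤j j<n

  Unique⇒index-lookup : ∀ {xs : List A} → Unique xs → (k : Fin (length xs)) (p : lookup xs k ∈ xs) →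
                        index p ≡ k
  Unique⇒index-lookup {_ ∷ _}  _            fzero    (here _)  = refl
  Unique⇒index-lookup {_ ∷ _}  (x∉xs ∷ _)   fzero    (there p) = ⊥-elim (All.lookup x∉xs p refl)
  Unique⇒index-lookup {_ ∷ xs} (x∉xs ∷ _)   (fsuc k) (here e)  =
    ⊥-elim (All.lookup x∉xs (∈-lookup {xs = xs} k) (sym e))
  Unique⇒index-lookup {_ ∷ _}  (_ ∷ u)      (fsuc k) (there p) = cong fsuc (Unique⇒index-lookup u k p)

  pairs : List A → List (A × A)
  pairs []       = []
  pairs (x ∷ xs) = map (x ,_) xs ++ pairs xs

  ∈-pairs : ∀ {q r : A} {xs} → q ∈ xs → r ∈ xs → q ≢ r → (q , r) ∈ pairs xs ⊎ (r , q) ∈ pairs xs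
  ∈-pairs (here refl) (here refl) q≢r = ⊥-elim (q≢r refl)
  ∈-pairs (here refl) (there r∈)  _   = inj₁ (∈-++⁺ˡ (∈-map⁺ _ r∈))
  ∈-pairs (there q∈)  (here refl) _   = inj₂ (∈-++⁺ˡ (∈-map⁺ _ q∈))
  ∈-pairs {xs = x ∷ xs} (there q∈) (there r∈) q≢r with ∈-pairs q∈ r∈ q≢r
  ... | inj₁ qr∈ = inj₁ (∈-++⁺ʳ (map (x ,_) xs) qr∈)
  ... | inj₂ rq∈ = inj₂ (∈-++⁺ʳ (map (x ,_) xs) rq∈)

  ↭-trans-prep : ∀ {x : A} {xs xs′ ys} → xs ↭ x ∷ xs′ → xs′ ↭ ys → xs ↭ x ∷ ys
  ↭-trans-prep xs↭ xs′↭ = ↭-trans xs↭ (↭-prep _ xs′↭)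

  length-pairs-take3 : (xs : List A) → length (pairs (take 3 xs)) ≤ 3
  length-pairs-take3 []                = z≤n
  length-pairs-take3 (_ ∷ [])          = z≤n
  length-pairs-take3 (_ ∷ _ ∷ [])      = s≤s z≤n
  length-pairs-take3 (_ ∷ _ ∷ _ ∷ _)   = ≤-refl

  interleave-↭ : ∀ {zs as as′} {z₁ z₂ z₃ a₁ a₂ a₃ : A} →
                 zs ↭ z₁ ∷ z₂ ∷ z₃ ∷ [] → as ↭ a₁ ∷ a₂ ∷ a₃ ∷ as′ →
                 z₃ ∷ a₃ ∷ z₂ ∷ a₂ ∷ z₁ ∷ a₁ ∷ as′ ↭ zs ++ as
  interleave-↭ {zs} {as} {as′} {z₁} {z₂} {z₃} {a₁} {a₂} {a₃} zs↭ as↭ = begin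
    z₃ ∷ a₃ ∷ z₂ ∷ a₂ ∷ z₁ ∷ a₁ ∷ as′   ↭⟨ shift z₁ (z₃ ∷ a₃ ∷ z₂ ∷ a₂ ∷ []) _ ⟩
    z₁ ∷ z₃ ∷ a₃ ∷ z₂ ∷ a₂ ∷ a₁ ∷ as′   ↭⟨ ↭-prep z₁ (shift z₂ (z₃ ∷ a₃ ∷ []) _) ⟩
    z₁ ∷ z₂ ∷ z₃ ∷ a₃ ∷ a₂ ∷ a₁ ∷ as′   ↭⟨ prep-zs (shift a₁ (a₃ ∷ a₂ ∷ []) _) ⟩
    z₁ ∷ z₂ ∷ z₃ ∷ a₁ ∷ a₃ ∷ a₂ ∷ as′   ↭⟨ prep-zs (↭-prep a₁ (↭-swap a₃ a₂ ↭-refl)) ⟩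
    (z₁ ∷ z₂ ∷ z₃ ∷ []) ++ a₁ ∷ a₂ ∷ a₃ ∷ as′ ↭⟨ ++⁺ (↭-sym zs↭) (↭-sym as↭) ⟩
    zs ++ as                           ∎
    where
    open PermutationReasoning
    prep-zs : ∀ {xs ys} → xs ↭ ys → z₁ ∷ z₂ ∷ z₃ ∷ xs ↭ z₁ ∷ z₂ ∷ z₃ ∷ ys
    prep-zs = ↭-prep z₁ ∘ ↭-prep z₂ ∘ ↭-prep z₃

  record Pool (P : A → Set) (k : ℕ) : Set a where
    field
      elems   : List A
      unique  : Unique elems
      members : All P elems
      size    : length elems ≡ k

  open Pool public

  module _ {P : A → Set} where

    Pool-empty : (R : Pool P 0) → elems R ≡ []
    Pool-empty record { elems = [] }    = refl
    Pool-empty record { elems = _ ∷ _ ; size = () }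

    Pool-remove : ∀ {k x} (R : Pool P (suc k)) → x ∈ elems R →
                  Σ (Pool P k) λ R′ → elems R ↭ x ∷ elems R′
    Pool-remove R x∈R with ∈-∃↭ x∈R
    ... | ys , R↭ = R′ , R↭
      where
      R′ = record
        { elems   = ys
        ; unique  = AllPairs.tail (Unique-resp-↭ R↭ (unique R))
        ; members = All.tail (All-resp-↭ R↭ (members R))
        ; size    = suc-injective (trans (sym (↭-length R↭)) (size R))
        }

module _ {v : ℕ} where

  enumeration : (xs : List (Fin v)) → Unique xs → (∀ y → y ∈ xs) → Permutation (length xs) v
  enumeration xs u cover = permutation (lookup xs) (λ y → index (cover y))
    (λ y → sym (lookup-index (cover y))) (λ k → Unique⇒index-lookup u k (cover (lookup xs k)))

  length-enumeration : (xs : List (Fin v)) → Unique xs → (∀ y → y ∈ xs) → length xs ≡ v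
  length-enumeration xs u cover = ↔⇒≡ (enumeration xs u cover)

  complement : List (Fin v) → List (Fin v)
  complement I = filter (λ y → ¬? (y ∈? I)) (allFin v)
    where open DecMembership _≟_

  complement-pool : ∀ I {k} → length (complement I) ≡ k → Pool (_∉ I) k
  complement-pool I |N|≡k = record
    { elems   = complement I
    ; unique  = Unique.filter⁺ _ (Unique.allFin⁺ v)
    ; members = all-filter _ (allFin v)
    ; size    = |N|≡k
    }

  complement-++-unique : ∀ {I} → Unique I → Unique (complement I ++ I)
  complement-++-unique {I} u =
    Unique.++⁺ (unique N-pool) u (λ (y∈N , y∈I) → All.lookup (members N-pool) y∈N y∈I)
    where
    N-pool = complement-pool I refl

  complement-++-cover : ∀ I y → y ∈ complement I ++ I
  complement-++-cover I y with y ∈? I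
    where open DecMembership _≟_
  ... | yes y∈I = ∈-++⁺ʳ (complement I) y∈I
  ... | no  y∉I = ∈-++⁺ˡ (∈-filter⁺ _ (∈-allFin y) y∉I)

module _ {v : ℕ} where

  Block-unique : (B : Block v) → Unique (p₁ B ∷ p₂ B ∷ p₃ B ∷ [])
  Block-unique B =
    (≢-toℕ (p₁<p₂ B) ∷ ≢-toℕ (<-trans (p₁<p₂ B) (p₂<p₃ B)) ∷ []) ∷ (≢-toℕ (p₂<p₃ B) ∷ []) ∷ [] ∷ []
    where
    ≢-toℕ : ∀ {x y : Fin v} → toℕ x < toℕ y → x ≢ y
    ≢-toℕ x<y = <⇒≢ x<y ∘ cong toℕ

  _∈B?_ : (x : Fin v) (B : Block v) → Dec (x ∈B B)
  x ∈B? B = (x ≟ p₁ B) ⊎-dec ((x ≟ p₂ B) ⊎-dec (x ≟ p₃ B))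

  inBlock-length≤3 : ∀ {B : Block v} {xs} → Unique xs → All (_∈B B) xs → length xs ≤ 3
  inBlock-length≤3 {B} u xs∈B = Unique-⊆⇒length≤ u (∈B⇒∈points ∘ All.lookup xs∈B)
    where
    ∈B⇒∈points : ∀ {x} → x ∈B B → x ∈ p₁ B ∷ p₂ B ∷ p₃ B ∷ []
    ∈B⇒∈points (inj₁ e)        = here e
    ∈B⇒∈points (inj₂ (inj₁ e)) = there (here e)
    ∈B⇒∈points (inj₂ (inj₂ e)) = there (there (here e))

  inBlock-complete : ∀ {B : Block v} {xs w} → Unique xs → All (_∈B B) xs → 3 ≤ length xs →
                     w ∈B B → w ∈ xs
  inBlock-complete {B} {xs} {w} u xs∈B 3≤|xs| w∈B with w ∈? xs
    where open DecMembership _≟_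
  ... | yes w∈xs = w∈xs
  ... | no  w∉xs = ⊥-elim (<-irrefl refl
        (≤-trans (s≤s 3≤|xs|) (inBlock-length≤3 {B = B} (¬Any⇒All¬ xs w∉xs ∷ u) (w∈B ∷ xs∈B))))

module _ {v : ℕ} (S : STS v) where

  Collinear : Fin v → Fin v → Fin v → Set
  Collinear x y z = Any (λ B → All (_∈B B) (x ∷ y ∷ z ∷ [])) (blocks S) × Unique (x ∷ y ∷ z ∷ [])

  Collinear? : ∀ x y z → Dec (Collinear x y z)
  Collinear? x y z =
    any? (λ B → All.all? (_∈B? B) (x ∷ y ∷ z ∷ [])) (blocks S) ×-dec DecUnique.unique? _≟_ _

  Collinear-↭ : ∀ {x y z x′ y′ z′} → x ∷ y ∷ z ∷ [] ↭ x′ ∷ y′ ∷ z′ ∷ [] →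
                Collinear x y z → Collinear x′ y′ z′
  Collinear-↭ xyz↭ (onBlock , u) = Any.map (All-resp-↭ xyz↭) onBlock , Unique-resp-↭ xyz↭ u

  Collinear-swapˡ : ∀ {x y z} → Collinear x y z → Collinear y x z
  Collinear-swapˡ = Collinear-↭ (↭-swap _ _ ↭-refl)

  Collinear-swapʳ : ∀ {x y z} → Collinear x y z → Collinear x z y
  Collinear-swapʳ = Collinear-↭ (↭-prep _ (↭-swap _ _ ↭-refl))

  Collinear-rotate : ∀ {x y z} → Collinear x y z → Collinear z x y
  Collinear-rotate = Collinear-swapˡ ∘ Collinear-swapʳ

  block⇒Collinear : ∀ {B} → B ∈ blocks S → Collinear (p₁ B) (p₂ B) (p₃ B)
  block⇒Collinear {B} B∈ =
    lose B∈ (inj₁ refl ∷ inj₂ (inj₁ refl) ∷ inj₂ (inj₂ refl) ∷ []) , Block-unique B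

  Collinear-third-unique : ∀ {x y q r} → Collinear x q r → Collinear y q r → x ≡ y
  Collinear-third-unique {x} {y} (on₁ , (x≢q ∷ x≢r ∷ []) ∷ (q≢r ∷ []) ∷ _)
                                 (on₂ , (y≢q ∷ y≢r ∷ []) ∷ _)
    with x ≟ y | find on₁ | find on₂
  ... | yes x≡y | _ | _ = x≡y
  ... | no x≢y | B , B∈ , x∈B ∷ q∈B ∷ r∈B ∷ [] | C , C∈ , y∈C ∷ q∈C ∷ r∈C ∷ []
    with unique S _ _ q≢r B C B∈ C∈ q∈B r∈B q∈C r∈C
  ... | refl =
    ⊥-elim (<-irrefl refl (inBlock-length≤3 {B = B} four-distinct (x∈B ∷ y∈C ∷ q∈B ∷ r∈B ∷ [])))
    where
    four-distinct = (x≢y ∷ x≢q ∷ x≢r ∷ []) ∷ (y≢q ∷ y≢r ∷ []) ∷ (q≢r ∷ []) ∷ [] ∷ []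

  Independent⇒¬Collinear : ∀ {I x y z} → IsIndependent S I → x ∈ I → y ∈ I → z ∈ I →
                           ¬ Collinear x y z
  Independent⇒¬Collinear {I} (_ , independent) x∈I y∈I z∈I (onBlock , u) with find onBlock
  ... | B , B∈ , xyz∈B =
    independent B B∈ (∈I (inj₁ refl) , ∈I (inj₂ (inj₁ refl)) , ∈I (inj₂ (inj₂ refl)))
    where
    ∈I : ∀ {w} → w ∈B B → w ∈ I
    ∈I w∈B = All.lookup (x∈I ∷ y∈I ∷ z∈I ∷ [])
                        (inBlock-complete {B = B} u xyz∈B (s≤s (s≤s (s≤s z≤n))) w∈B)

  Avoids : Fin v → List (Fin v × Fin v) → Set
  Avoids x []              = ⊤
  Avoids x ((q , r) ∷ qrs) = ¬ Collinear x q r × Avoids x qrs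

  Avoids-∈ : ∀ {x q r qrs} → Avoids x qrs → (q , r) ∈ qrs → ¬ Collinear x q r
  Avoids-∈ {qrs = _ ∷ _} (¬c , _)  (here refl) = ¬c
  Avoids-∈ {qrs = _ ∷ _} (_ , ok) (there qr∈)  = Avoids-∈ ok qr∈

  Avoids-++⁻ : ∀ {x} qrs {qrs′} → Avoids x (qrs ++ qrs′) → Avoids x qrs × Avoids x qrs′
  Avoids-++⁻ []              ok        = tt , ok
  Avoids-++⁻ ((q , r) ∷ qrs) (¬c , ok) with Avoids-++⁻ qrs ok
  ... | ok₁ , ok₂ = (¬c , ok₁) , ok₂

  -- Each pair (q , r) rules out at most one point, the third point of the block through q and r.
  avoiding-point : ∀ {P k} (R : Pool P (suc k)) qrs → length qrs ≤ k →
                   ∃ λ x → x ∈ elems R × Avoids x qrs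
  avoiding-point record { elems = x ∷ _ }         [] _ = x , here refl , tt
  avoiding-point record { elems = [] ; size = () } [] _
  avoiding-point R ((q , r) ∷ qrs) (s≤s |qrs|≤k) with any? (λ y → Collinear? y q r) (elems R)
  ... | no none with avoiding-point R qrs (m≤n⇒m≤1+n |qrs|≤k)
  ...   | x , x∈R , ok = x , x∈R , none ∘ lose x∈R , ok
  avoiding-point R ((q , r) ∷ qrs) (s≤s |qrs|≤k) | yes some with find some
  ... | y , y∈R , yqr with Pool-remove R y∈R
  ...   | R′ , R↭ with avoiding-point R′ qrs |qrs|≤k
  ...     | x , x∈R′ , ok = x , ∈-resp-↭ (↭-sym R↭) (there x∈R′) , x≢third , ok
    where
    x≢third : ¬ Collinear x q r
    x≢third xqr with Collinear-third-unique yqr xqr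
    ... | refl = All.lookup (AllPairs.head (Unique-resp-↭ R↭ (unique R))) x∈R′ refl

  draw : ∀ {P k} (R : Pool P (suc k)) qrs → length qrs ≤ k →
         ∃ λ x → P x × Avoids x qrs × Σ (Pool P k) λ R′ → elems R ↭ x ∷ elems R′
  draw R qrs |qrs|≤k with avoiding-point R qrs |qrs|≤k
  ... | x , x∈R , ok = x , All.lookup (members R) x∈R , ok , Pool-remove R x∈R

  Avoids-pairs : ∀ {x q r W} → Avoids x (pairs W) → q ∈ W → r ∈ W → ¬ Collinear x q r
  Avoids-pairs ok q∈W r∈W xqr@(_ , (_ ∷ _ ∷ []) ∷ (q≢r ∷ []) ∷ _) with ∈-pairs q∈W r∈W q≢r
  ... | inj₁ qr∈ = Avoids-∈ ok qr∈ xqr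
  ... | inj₂ rq∈ = Avoids-∈ ok rq∈ (Collinear-swapʳ xqr)

  BlockFree : List (Fin v) → Set
  BlockFree W = ∀ {B} → B ∈ blocks S → ¬ (B ⊆P (_∈ W))

  BlockFree-∷ : ∀ {x W} → BlockFree W → Avoids x (pairs W) → BlockFree (x ∷ W)
  BlockFree-∷ free ok {B} B∈ (m₁ , m₂ , m₃)
    with (p₁≢p₂ ∷ p₁≢p₃ ∷ []) ∷ (p₂≢p₃ ∷ []) ∷ _ ← Block-unique B | m₁ | m₂ | m₃
  ... | here e₁   | here e₂   | _         = p₁≢p₂ (trans e₁ (sym e₂))
  ... | here e₁   | there _   | here e₃   = p₁≢p₃ (trans e₁ (sym e₃))
  ... | there _   | here e₂   | here e₃   = p₂≢p₃ (trans e₂ (sym e₃))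
  ... | here refl | there i₂  | there i₃  = Avoids-pairs ok i₂ i₃ (block⇒Collinear B∈)
  ... | there i₁  | here refl | there i₃  = Avoids-pairs ok i₁ i₃ (Collinear-swapˡ (block⇒Collinear B∈))
  ... | there i₁  | there i₂  | here refl = Avoids-pairs ok i₁ i₂ (Collinear-rotate (block⇒Collinear B∈))
  ... | there i₁  | there i₂  | there i₃  = free B∈ (i₁ , i₂ , i₃)

  -- Sequences are built by prepending, so the head of a list is the last point placed.
  FourGood : List (Fin v) → Set
  FourGood []       = ⊤
  FourGood (x ∷ xs) = BlockFree (x ∷ take 3 xs) × FourGood xs

  FourGood⇒BlockFree-window : ∀ xs i → FourGood xs → BlockFree (take 4 (drop i xs))
  FourGood⇒BlockFree-window []       zero    _          _ (() , _)
  FourGood⇒BlockFree-window []       (suc i) _          _ (() , _)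
  FourGood⇒BlockFree-window (x ∷ xs) zero    (free , _) = free
  FourGood⇒BlockFree-window (x ∷ xs) (suc i) (_ , good) = FourGood⇒BlockFree-window xs i good

  FourGood-∷ : ∀ {x xs} → FourGood xs → Avoids x (pairs (take 3 xs)) → FourGood (x ∷ xs)
  FourGood-∷ {xs = []}     good ok = BlockFree-∷ (λ { _ (() , _) }) ok , good
  FourGood-∷ {xs = y ∷ ys} good ok = BlockFree-∷ (window-free good) ok , good
    where
    window-free : FourGood (y ∷ ys) → BlockFree (take 3 (y ∷ ys))
    window-free (free , _) B∈ (i₁ , i₂ , i₃) =
      free B∈ (∈-take-suc 3 (y ∷ ys) i₁ , ∈-take-suc 3 (y ∷ ys) i₂ , ∈-take-suc 3 (y ∷ ys) i₃)

  place : ∀ {P k} (F : List (Fin v)) → FourGood F →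
          (R : Pool P (suc k)) (look : List (Fin v × Fin v)) → 3 + length look ≤ k →
          ∃ λ x → P x × Avoids x look × FourGood (x ∷ F) ×
                  Σ (Pool P k) λ R′ → elems R ↭ x ∷ elems R′
  place F good R look 3+|look|≤k with draw R (pairs (take 3 F) ++ look) |pairs++look|≤k
    where
    |pairs++look|≤k = ≤-trans (≤-reflexive (length-++ (pairs (take 3 F))))
                              (≤-trans (+-monoˡ-≤ (length look) (length-pairs-take3 F)) 3+|look|≤k)
  ... | x , Px , ok , rest with Avoids-++⁻ (pairs (take 3 F)) ok
  ...   | ok-window , ok-look = x , Px , ok-look , FourGood-∷ good ok-window , rest

  greedy : ∀ {P} n (L : List (Fin v)) (R : Pool P (n + 3)) → FourGood L →
           ∃₂ λ L′ (R′ : Pool P 3) → FourGood L′ × L′ ++ elems R′ ↭ L ++ elems R ×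
                                     length L′ ≡ n + length L
  greedy zero    L R good = L , R , good , ↭-refl , refl
  greedy (suc n) L R good with place L good R [] (m≤n+m 3 n)
  ... | x , _ , _ , good₁ , R₁ , R↭ with greedy n (x ∷ L) R₁ good₁
  ...   | L′ , R′ , good′ , L′↭ , |L′| = L′ , R′ , good′ , L′↭′ , trans |L′| (+-suc n (length L))
    where
    L′↭′ : L′ ++ elems R′ ↭ L ++ elems R
    L′↭′ = ↭-trans L′↭ (↭-trans (↭-sym (shift x L (elems R₁))) (++⁺ˡ L (↭-sym R↭)))

  -- The z's have no freedom left when they are placed, so each aᵢ also avoids in
  -- advance the pairs that close a triple with a later z.
  tail-interleave : ∀ {P Q} (L : List (Fin v)) → 3 ≤ length L → FourGood L →
                    (Z : Pool P 3) (A : Pool Q 8) →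
                    ∃₂ λ z W → FourGood (z ∷ W ++ L) ×
                               Σ (Pool Q 5) λ A′ → z ∷ W ++ elems A′ ↭ elems Z ++ elems A
  tail-interleave []                ()
  tail-interleave (_ ∷ [])          (s≤s ())
  tail-interleave (_ ∷ _ ∷ [])      (s≤s (s≤s ()))
  tail-interleave L@(y₃ ∷ y₂ ∷ _ ∷ _) _ good Z A
    with draw Z ((y₃ , y₂) ∷ []) (s≤s z≤n)
  ... | z₁ , _ , (z₁y₃y₂ , _) , Z₁ , Z↭₁ with draw Z₁ [] z≤n
  ... | z₂ , _ , _ , Z₂ , Z↭₂ with draw Z₂ [] z≤n
  ... | z₃ , _ , _ , Z₃ , Z↭₃
    with place L good A ((z₁ , y₃) ∷ (z₁ , y₂) ∷ (z₂ , z₁) ∷ []) (n≤1+n 6)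
  ... | a₁ , _ , (a₁z₁y₃ , a₁z₁y₂ , a₁z₂z₁ , _) , good₁ , A₁ , A↭₁
    with place (z₁ ∷ a₁ ∷ L)
              (FourGood-∷ good₁ (a₁z₁y₃ ∘ Collinear-swapˡ , a₁z₁y₂ ∘ Collinear-swapˡ , z₁y₃y₂ , tt))
              A₁ ((z₂ , z₁) ∷ (z₂ , a₁) ∷ (z₃ , z₂) ∷ []) ≤-refl
  ... | a₂ , _ , (a₂z₂z₁ , a₂z₂a₁ , a₂z₃z₂ , _) , good₂ , A₂ , A↭₂
    with place (z₂ ∷ a₂ ∷ z₁ ∷ a₁ ∷ L)
              (FourGood-∷ good₂
                (a₂z₂z₁ ∘ Collinear-swapˡ , a₂z₂a₁ ∘ Collinear-swapˡ , a₁z₂z₁ ∘ Collinear-rotate , tt))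
              A₂ ((z₃ , z₂) ∷ (z₃ , a₂) ∷ []) ≤-refl
  ... | a₃ , _ , (a₃z₃z₂ , a₃z₃a₂ , _) , good₃ , A₃ , A↭₃ =
    z₃ , a₃ ∷ z₂ ∷ a₂ ∷ z₁ ∷ a₁ ∷ [] ,
    FourGood-∷ good₃
      (a₃z₃z₂ ∘ Collinear-swapˡ , a₃z₃a₂ ∘ Collinear-swapˡ , a₂z₃z₂ ∘ Collinear-rotate , tt) ,
    A₃ , interleave-↭
           (↭-trans-prep Z↭₁ (↭-trans-prep Z↭₂ (↭-trans-prep Z↭₃ (↭-reflexive (Pool-empty Z₃)))))
           (↭-trans-prep A↭₁ (↭-trans-prep A↭₂ (↭-trans-prep A↭₃ ↭-refl)))

  tail-run : ∀ {I} → IsIndependent S I → (z : Fin v) (F : List (Fin v)) → FourGood (z ∷ F) →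
             (A : Pool (_∈ I) 5) → ∃ λ W → FourGood (W ++ z ∷ F) × W ↭ elems A
  tail-run {I} indep z F good A with place (z ∷ F) good A [] (n≤1+n 3)
  ... | a₄ , a₄∈I , _ , good₁ , A₄ , A↭₄ with place (a₄ ∷ z ∷ F) good₁ A₄ [] ≤-refl
  ... | a₅ , a₅∈I , _ , good₂ , A₅ , A↭₅ with draw A₅ ((a₅ , z) ∷ (a₄ , z) ∷ []) ≤-refl
  ... | a₆ , a₆∈I , (a₆a₅z , a₆a₄z , _) , A₆ , A↭₆ with draw A₆ [] z≤n
  ... | a₇ , a₇∈I , _ , A₇ , A↭₇ with draw A₇ [] z≤n
  ... | a₈ , a₈∈I , _ , A₈ , A↭₈ =
    W , good′ , ↭-trans (↭-sym (↭-reverse W)) (↭-sym A↭)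
    where
    ¬C : ∀ {x y z} → x ∈ I → y ∈ I → z ∈ I → ¬ Collinear x y z
    ¬C = Independent⇒¬Collinear indep
    W = a₈ ∷ a₇ ∷ a₆ ∷ a₅ ∷ a₄ ∷ []
    good′ : FourGood (W ++ z ∷ F)
    good′ = FourGood-∷ (FourGood-∷ (FourGood-∷ good₂
              (¬C a₆∈I a₅∈I a₄∈I , a₆a₅z , a₆a₄z , tt))
              (¬C a₇∈I a₆∈I a₅∈I , ¬C a₇∈I a₆∈I a₄∈I , ¬C a₇∈I a₅∈I a₄∈I , tt))
              (¬C a₈∈I a₇∈I a₆∈I , ¬C a₈∈I a₇∈I a₅∈I , ¬C a₈∈I a₆∈I a₅∈I , tt)
    A↭ : elems A ↭ a₄ ∷ a₅ ∷ a₆ ∷ a₇ ∷ a₈ ∷ []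
    A↭ = ↭-trans-prep A↭₄ (↭-trans-prep A↭₅ (↭-trans-prep A↭₆
           (↭-trans-prep A↭₇ (↭-trans-prep A↭₈ (↭-reflexive (Pool-empty A₈))))))

  tail : ∀ {P I} → IsIndependent S I → (L : List (Fin v)) → 3 ≤ length L → FourGood L →
         (Z : Pool P 3) (A : Pool (_∈ I) 8) → ∃ λ F → FourGood F × F ↭ L ++ elems Z ++ elems A
  tail indep L 3≤|L| good Z A =
    let z , W , good₁ , A′ , W↭ = tail-interleave L 3≤|L| good Z A
        W′ , good₂ , W′↭ = tail-run indep z (W ++ L) good₁ A′
    in W′ ++ z ∷ W ++ L , good₂ , (begin
      W′ ++ (z ∷ W) ++ L   ↭⟨ shifts W′ (z ∷ W) ⟩
      (z ∷ W) ++ W′ ++ L   ↭⟨ ++⁺ˡ (z ∷ W) (++-comm W′ L) ⟩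
      (z ∷ W) ++ L ++ W′   ↭⟨ shifts (z ∷ W) L ⟩
      L ++ (z ∷ W) ++ W′   ↭⟨ ++⁺ˡ L (↭-trans (++⁺ˡ (z ∷ W) W′↭) W↭) ⟩
      L ++ elems Z ++ elems A ∎)
    where open PermutationReasoning

  FourGood⇒sequencing : (F : List (Fin v)) → Unique F → (∀ y → y ∈ F) → FourGood F →
                        Σ (Permutation′ v) λ σ → IsGoodSequencing S 4 σ
  FourGood⇒sequencing F u cover good = σ , σ-good
    where
    σ : Permutation′ v
    σ = cast-id (sym (length-enumeration F u cover)) ∘ₚ enumeration F u cover

    -- FourGood also covers the truncated windows at the end.
    σ-good : IsGoodSequencing S 4 σ
    σ-good i _ _ B∈ (h₁ , h₂ , h₃) =
      FourGood⇒BlockFree-window F i good B∈ (in-window h₁ , in-window h₂ , in-window h₃)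
      where
      in-window : ∀ {y} → Σ (Fin v) (λ j → i ≤ toℕ j × toℕ j < i + 4 × σ ⟨$⟩ʳ j ≡ y) →
                  y ∈ take 4 (drop i F)
      in-window (j , i≤j , j<i+4 , refl) =
        lookup∈window F i (cast _ j) (subst (i ≤_) (sym (toℕ-cast _ j)) i≤j)
                                     (subst (_< i + 4) (sym (toℕ-cast _ j)) j<i+4)

  FourGood-arrangement : ∀ {I} → IsIndependent S I → length I ≡ 8 → 11 ≤ length (complement I) →
                         ∃ λ F → FourGood F × F ↭ complement I ++ I
  FourGood-arrangement {I} indep |I|≡8 11≤|N| =
    let L , Z , good , L↭ , |L| = greedy n [] N-pool tt
        F , good′ , F↭ = tail indep L (subst (3 ≤_) (sym (trans |L| (+-identityʳ n))) 3≤n) good Z I-pool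
    in F , good′ , ↭-trans F↭ (↭-trans (↭-reflexive (sym (++-assoc L (elems Z) I))) (++⁺ʳ I L↭))
    where
    n = length (complement I) ∸ 3
    3≤n : 3 ≤ n
    3≤n = ≤-trans (s≤s (s≤s (s≤s z≤n))) (∸-monoˡ-≤ 3 11≤|N|)
    N-pool : Pool (_∉ I) (n + 3)
    N-pool = complement-pool I (sym (m∸n+n≡m (≤-trans (s≤s (s≤s (s≤s z≤n))) 11≤|N|)))
    I-pool : Pool (_∈ I) 8
    I-pool = record { elems = I ; unique = proj₁ indep ; members = All.tabulate id ; size = |I|≡8 }

theorem2p1 : (v : ℕ) → 19 ≤ v → (S : STS v) →
    (Σ (List (Fin v)) λ I → IsIndependent S I × length I ≡ 8) →
    Σ (Permutation′ v) λ σ → IsGoodSequencing S 4 σ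
theorem2p1 v 19≤v S (I , indep , |I|≡8) =
  let F , good , F↭ = FourGood-arrangement S indep |I|≡8 11≤|N|
  in FourGood⇒sequencing S F (Unique-resp-↭ (↭-sym F↭) P-unique) (∈-resp-↭ (↭-sym F↭) ∘ P-cover) good
  where
  P-unique = complement-++-unique (proj₁ indep)
  P-cover  = complement-++-cover I
  11≤|N| : 11 ≤ length (complement I)
  11≤|N| = +-cancelʳ-≤ 8 11 _ (subst (19 ≤_) (begin
    v                                    ≡⟨ sym (length-enumeration _ P-unique P-cover) ⟩
    length (complement I ++ I)           ≡⟨ length-++ (complement I) ⟩
    length (complement I) + length I     ≡⟨ cong (length (complement I) +_) |I|≡8 ⟩
    length (complement I) + 8            ∎) 19≤v)
    where open ≡-Reasoning
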